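{- Let $G=S_q$ with $q\ge4$ act on a $q$-letter alphabet. If a pattern $p$ of length $\ell$ satisfies $p\mathcal{L}p=q^{\ell-1}+q-1$, then $p$ contains exactly two distinct letters.
   Context: $S_q$ permutes the letters of the alphabet and acts on words letterwise; a pattern is an $S_q$-orbit of words, represented by its lexicographically least word, with substrings $p(i,j)$ taken in this representative. $G_p$ is the stabilizer of the words of $p$. For a pattern $p$ of length $\ell$, $\mathcal{C}_i(p,p)=|G_x|/|G_p|$ if the suffix $x=p(i+1,\ell)$ is in the same orbit as the prefix $p(1,\ell-i)$, and $0$ otherwise; $p\mathcal{L}p=\sum_{i=0}^{\ell-1}\mathcal{C}_i(p,p)q^{\ell-1-i}$. -}

module Defs where

open import Data.Nat using (ℕ; zero; suc; _+_; _*_; _∸_; _^_; _!)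
open import Data.Fin using (Fin; _<_; _≟_)
open import Data.Fin.Permutation using (Permutation′; _⟨$⟩ʳ_)
open import Data.List using (List; []; _∷_; map; length; filter; take; drop; upTo; allFin)
open import Data.Nat.ListAction using (sum)
open import Data.List.Membership.DecPropositional using () renaming (_∈?_ to mem?)
open import Data.Product using (Σ; _×_)
open import Data.Sum using (_⊎_)
open import Relation.Nullary using (¬_)
open import Relation.Binary.PropositionalEquality using (_≡_)

Word : ℕ → Set
Word q = List (Fin q)

act : ∀ {q} → Permutation′ q → Word q → Word q
act σ w = map (σ ⟨$⟩ʳ_) w

SameOrbit : ∀ {q} → Word q → Word q → Set
SameOrbit {q} x y = Σ (Permutation′ q) λ σ → act σ x ≡ y

-- Lexicographic (non-strict) order on words (words here are compared
-- only with words of the same length).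
data _≤lex_ {q : ℕ} : Word q → Word q → Set where
  []≤   : ∀ {ys} → [] ≤lex ys
  here  : ∀ {x y xs ys} → x < y → (x ∷ xs) ≤lex (y ∷ ys)
  there : ∀ {x xs ys} → xs ≤lex ys → (x ∷ xs) ≤lex (x ∷ ys)

-- A pattern, given by its representative: the lexicographically least
-- word of its S_q-orbit.
IsPattern : ∀ {q} → Word q → Set
IsPattern {q} p = ∀ (σ : Permutation′ q) → p ≤lex act σ p

numLetters : ∀ {q} → Word q → ℕ
numLetters {q} w = length (filter (λ a → mem? _≟_ a w) (allFin q))

-- |G_w|: order of the stabilizer in S_q of a word w.  The stabilizer of w
-- is the pointwise stabilizer of the set of letters of w, i.e. S_{q-k}
-- where k is the number of distinct letters of w.
stabSize : ∀ {q} → Word q → ℕ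
stabSize {q} w = (q ∸ numLetters w) !

-- With ℓ = length p, x = p(i+1,ℓ) = drop i p, and the prefix
-- p(1,ℓ-i) = take (ℓ ∸ i) p.  C_i = |G_x|/|G_p| (stated multiplicatively,
-- it is always an integer) if x is in the orbit of the prefix, and 0 otherwise.
CoeffIs : ∀ {q} → Word q → ℕ → ℕ → Set
CoeffIs p i c =
  (SameOrbit (drop i p) (take (length p ∸ i) p) × c * stabSize p ≡ stabSize (drop i p))
  ⊎ (¬ SameOrbit (drop i p) (take (length p ∸ i) p) × c ≡ 0)

autoCorr : ℕ → ℕ → (ℕ → ℕ) → ℕ
autoCorr q ℓ c = sum (map (λ i → c i * q ^ (ℓ ∸ 1 ∸ i)) (upTo ℓ))

{-# OPTIONS --safe #-}
-- Since C_0(p,p) = 1, the equation reads  q^(ℓ-1) + Σ_{0<i<ℓ-1} C_i q^(ℓ-1-i) + C_(ℓ-1) = q^(ℓ-1) + (q-1).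
-- The middle sum is a multiple of q and q - 1 < q, so it vanishes and C_(ℓ-1)(p,p) = q - 1.
-- The suffix of length 1 is a single letter, whose stabilizer is S_(q-1), while that of p is
-- S_(q-k) for the number k of letters of p; hence (q-1)·(q-k)! = (q-1)!, i.e. (q-k)! = (q-2)!.
-- As q - 2 ≥ 2 the factorial is injective there, so k = 2.
module Submission where

open import Defs
open import Data.Nat using (ℕ; zero; suc; _+_; _*_; _∸_; _^_; _!; _≤_; _<_; z≤n; s≤s)
open import Data.Nat.Properties
open import Data.Fin using (Fin) renaming (_≟_ to _≟ᶠ_)
open import Data.Fin.Permutation using (id)
open import Data.List using (List; []; _∷_; [_]; length; map; filter; drop; upTo; applyUpTo; allFin)
open import Data.List.Properties
  using (map-cong; map-id; map-applyUpTo; take-all; length-filter; length-tabulate; filter-accept; filter-reject; filter-none)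
open import Data.Nat.ListAction using (sum)
open import Data.List.Membership.Propositional using (_∈_)
open import Data.List.Membership.DecPropositional using () renaming (_∈?_ to mem?)
open import Data.List.Membership.Propositional.Properties using (∈-allFin)
open import Data.List.Relation.Unary.All as All using ()
open import Data.List.Relation.Unary.Any using (here; there)
open import Data.List.Relation.Unary.AllPairs using (_∷_)
open import Data.List.Relation.Unary.Unique.Propositional using (Unique)
open import Data.List.Relation.Unary.Unique.Propositional.Properties using (allFin⁺)
open import Data.Product using (Σ; _,_; proj₁; proj₂)
open import Data.Sum using (inj₁; inj₂)
open import Function using (_∘_)
open import Relation.Nullary using (contradiction)
open import Relation.Unary using (Pred; Decidable)
open import Relation.Binary.PropositionalEquality using (_≡_; _≢_; refl; sym; trans; cong; subst; module ≡-Reasoning)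
open import Relation.Binary.Definitions using (tri<; tri≈; tri>)
open import Level using (Level)
open import Data.Nat.Solver using (module +-*-Solver)
open +-*-Solver using (solve; _:+_; _:*_; _:=_; con)

private
  variable
    a p : Level
    A : Set a

length-filter-unique≡1 : {P : Pred A p} (P? : Decidable P) {x : A} {xs : List A} →
  Unique xs → x ∈ xs → P x → (∀ {y} → P y → y ≡ x) → length (filter P? xs) ≡ 1
length-filter-unique≡1 P? (x≢ys ∷ _) (here refl) Px only-x =
  trans (cong length (filter-accept P? Px))
        (cong suc (cong length (filter-none P? (All.map (λ x≢y Py → x≢y (sym (only-x Py))) x≢ys))))
length-filter-unique≡1 P? (y≢ys ∷ ys-unique) (there x∈ys) Px only-x =
  trans (cong length (filter-reject P? (λ Py → All.lookup y≢ys x∈ys (only-x Py))))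
        (length-filter-unique≡1 P? ys-unique x∈ys Px only-x)

m*n+o≡p⇒o≡p : ∀ m n {o p} → p < m → m * n + o ≡ p → o ≡ p
m*n+o≡p⇒o≡p m zero {o} _ eq = trans (cong (_+ o) (sym (*-zeroʳ m))) eq
m*n+o≡p⇒o≡p m (suc n) {o} p<m eq = contradiction p<m (≤⇒≯ m≤p)
  where
  m≤p : m ≤ _
  m≤p = subst (m ≤_) eq (≤-trans (m≤m*n m (suc n)) (m≤m+n (m * suc n) o))

!-mono-≤ : ∀ {m n} → m ≤ n → m ! ≤ n !
!-mono-≤ {n = zero} z≤n = ≤-refl
!-mono-≤ {n = suc n} m≤1+n with m≤n⇒m<n∨m≡n m≤1+n
... | inj₂ refl = ≤-refl
... | inj₁ (s≤s m≤n) = ≤-trans (!-mono-≤ m≤n) (m≤m+n (n !) (n * n !))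

!-mono-< : ∀ {m n} → 2 ≤ n → m < n → m ! < n !
!-mono-< {n = suc n} (s≤s 1≤n) (s≤s m≤n) = begin-strict
  _           ≤⟨ !-mono-≤ m≤n ⟩
  n !         <⟨ m<m*n (n !) (suc n) {{n !≢0}} (s≤s 1≤n) ⟩
  n ! * suc n ≡⟨ *-comm (n !) (suc n) ⟩
  suc n !     ∎
  where open ≤-Reasoning

!-injective-≥2 : ∀ {m n} → 2 ≤ n → m ! ≡ n ! → m ≡ n
!-injective-≥2 {m} {n} 2≤n eq with <-cmp m n
... | tri< m<n _ _ = contradiction eq (<⇒≢ (!-mono-< 2≤n m<n))
... | tri≈ _ m≡n _ = m≡n
... | tri> _ _ n<m = contradiction (sym eq) (<⇒≢ (!-mono-< (≤-trans 2≤n (<⇒≤ n<m)) n<m))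

numLetters-[x] : ∀ {q} (x : Fin q) → numLetters [ x ] ≡ 1
numLetters-[x] {q} x =
  length-filter-unique≡1 (λ y → mem? _≟ᶠ_ y [ x ]) (allFin⁺ q) (∈-allFin x) (here refl) only-x
  where
  only-x : ∀ {y} → y ∈ [ x ] → y ≡ x
  only-x (here y≡x) = y≡x

numLetters≤q : ∀ {q} (w : Word q) → numLetters w ≤ q
numLetters≤q {q} w =
  ≤-trans (length-filter (λ y → mem? _≟ᶠ_ y w) (allFin q)) (≤-reflexive (length-tabulate {n = q} (λ y → y)))

drop-all-but-last : ∀ {q} (y : Fin q) ys → Σ (Fin q) λ x → drop (length ys) (y ∷ ys) ≡ [ x ]
drop-all-but-last y [] = y , refl
drop-all-but-last y (z ∷ zs) = drop-all-but-last z zs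

coeff-0≡1 : ∀ {q} (p : Word q) {c} → CoeffIs p 0 c → c ≡ 1
coeff-0≡1 {q} p {c} (inj₁ (_ , c*G≡G)) =
  *-cancelʳ-≡ c 1 (stabSize p) {{(q ∸ numLetters p) !≢0}} (trans c*G≡G (sym (*-identityˡ _)))
coeff-0≡1 p (inj₂ (¬orbit , _)) =
  contradiction (id , trans (map-id p) (sym (take-all (length p) p ≤-refl))) ¬orbit

coeff-stabilizer : ∀ {q} (p : Word q) i {c} → CoeffIs p i c → c ≢ 0 → c * stabSize p ≡ stabSize (drop i p)
coeff-stabilizer p i (inj₁ (_ , c*G≡G)) _ = c*G≡G
coeff-stabilizer p i (inj₂ (_ , c≡0)) c≢0 = contradiction c≡0 c≢0

autoCorr-suc : ∀ q ℓ c → autoCorr q (suc ℓ) c ≡ c 0 * q ^ ℓ + autoCorr q ℓ (c ∘ suc)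
autoCorr-suc q ℓ c = cong (c 0 * q ^ ℓ +_) (cong sum shift)
  where
  term : ℕ → ℕ
  term i = c i * q ^ (ℓ ∸ i)
  shift : map term (applyUpTo suc ℓ) ≡ map (λ i → c (suc i) * q ^ (ℓ ∸ 1 ∸ i)) (upTo ℓ)
  shift = trans (map-applyUpTo suc term ℓ)
                (trans (sym (map-applyUpTo (λ i → i) (term ∘ suc) ℓ))
                       (map-cong (λ i → cong (λ e → c (suc i) * q ^ e) (sym (∸-+-assoc ℓ 1 i))) (upTo ℓ)))

autoCorr-snoc : ∀ q ℓ c → autoCorr q (suc ℓ) c ≡ q * autoCorr q ℓ c + c ℓ
autoCorr-snoc q zero c = solve 2 (λ q c₀ → c₀ :* con 1 :+ con 0 := q :* con 0 :+ c₀) refl q (c 0)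
autoCorr-snoc q (suc ℓ) c = begin
  autoCorr q (suc (suc ℓ)) c                                 ≡⟨ autoCorr-suc q (suc ℓ) c ⟩
  c 0 * q ^ suc ℓ + autoCorr q (suc ℓ) (c ∘ suc)             ≡⟨ cong (c 0 * q ^ suc ℓ +_) (autoCorr-snoc q ℓ (c ∘ suc)) ⟩
  c 0 * q ^ suc ℓ + (q * autoCorr q ℓ (c ∘ suc) + c (suc ℓ)) ≡⟨ horner q (c 0) (q ^ ℓ) (autoCorr q ℓ (c ∘ suc)) (c (suc ℓ)) ⟩
  q * (c 0 * q ^ ℓ + autoCorr q ℓ (c ∘ suc)) + c (suc ℓ)     ≡⟨ cong (λ s → q * s + c (suc ℓ)) (autoCorr-suc q ℓ c) ⟨
  q * autoCorr q (suc ℓ) c + c (suc ℓ)                       ∎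
  where
  open ≡-Reasoning
  horner : ∀ q c₀ u v w → c₀ * (q * u) + (q * v + w) ≡ q * (c₀ * u + v) + w
  horner = solve 5 (λ q c₀ u v w → c₀ :* (q :* u) :+ (q :* v :+ w) := q :* (c₀ :* u :+ v) :+ w) refl

autoCorr-last-coeff : ∀ {q} ℓ c → 2 ≤ q → c 0 ≡ 1 → autoCorr q (suc ℓ) c ≡ q ^ ℓ + q ∸ 1 → c ℓ ≡ q ∸ 1
autoCorr-last-coeff {q@(suc (suc _))} ℓ c (s≤s (s≤s _)) c₀≡1 eq = last ℓ tail≡
  where
  open ≡-Reasoning
  tail≡ : autoCorr q ℓ (c ∘ suc) ≡ q ∸ 1
  tail≡ = +-cancelˡ-≡ (q ^ ℓ) _ _ (begin
    q ^ ℓ + autoCorr q ℓ (c ∘ suc)       ≡⟨ cong (_+ autoCorr q ℓ (c ∘ suc)) (*-identityˡ (q ^ ℓ)) ⟨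
    1 * q ^ ℓ + autoCorr q ℓ (c ∘ suc)   ≡⟨ cong (λ c₀ → c₀ * q ^ ℓ + autoCorr q ℓ (c ∘ suc)) c₀≡1 ⟨
    c 0 * q ^ ℓ + autoCorr q ℓ (c ∘ suc) ≡⟨ autoCorr-suc q ℓ c ⟨
    autoCorr q (suc ℓ) c                 ≡⟨ eq ⟩
    q ^ ℓ + q ∸ 1                        ≡⟨ +-∸-assoc (q ^ ℓ) (s≤s z≤n) ⟩
    q ^ ℓ + (q ∸ 1)                      ∎)
  last : ∀ m → autoCorr q m (c ∘ suc) ≡ q ∸ 1 → c m ≡ q ∸ 1
  last zero ()
  last (suc m) rest≡ =
    m*n+o≡p⇒o≡p q (autoCorr q m (c ∘ suc)) (n<1+n (q ∸ 1)) (trans (sym (autoCorr-snoc q m (c ∘ suc))) rest≡)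

[q∸1]*[q∸k]!≡[q∸1]!⇒k≡2 : ∀ {q k} → 4 ≤ q → k ≤ q → (q ∸ 1) * (q ∸ k) ! ≡ (q ∸ 1) ! → k ≡ 2
[q∸1]*[q∸k]!≡[q∸1]!⇒k≡2 {suc (suc n)} {k} (s≤s (s≤s 2≤n)) k≤q eq =
  ∸-cancelˡ-≡ k≤q (s≤s (s≤s z≤n)) (!-injective-≥2 2≤n (*-cancelˡ-≡ _ _ (suc n) eq))

mainTheorem11 : (q : ℕ) → 4 ≤ q → (p : Word q) → IsPattern p →
    (c : ℕ → ℕ) → (∀ i → i < length p → CoeffIs p i (c i)) →
    autoCorr q (length p) c ≡ q ^ (length p ∸ 1) + q ∸ 1 →
    numLetters p ≡ 2
-- For p = [] the equation reduces to 0 ≡ q.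
mainTheorem11 q 4≤q [] _ _ _ eq = contradiction eq (<⇒≢ (≤-trans (s≤s z≤n) 4≤q))
mainTheorem11 q 4≤q p@(y ∷ ys) _ c coeff eq =
  [q∸1]*[q∸k]!≡[q∸1]!⇒k≡2 4≤q (numLetters≤q p) (begin
    (q ∸ 1) * stabSize p     ≡⟨ cong (_* stabSize p) c-last ⟨
    c ℓ * stabSize p         ≡⟨ coeff-stabilizer p ℓ (coeff ℓ ≤-refl) c-last≢0 ⟩
    stabSize (drop ℓ p)      ≡⟨ cong stabSize drop≡[x] ⟩
    stabSize [ x ]           ≡⟨ cong (λ k → (q ∸ k) !) (numLetters-[x] x) ⟩
    (q ∸ 1) !                ∎)
  where
  open ≡-Reasoning
  ℓ = length ys
  2≤q : 2 ≤ q
  2≤q = ≤-trans (s≤s (s≤s z≤n)) 4≤q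
  c-last : c ℓ ≡ q ∸ 1
  c-last = autoCorr-last-coeff ℓ c 2≤q (coeff-0≡1 p (coeff 0 (s≤s z≤n))) eq
  c-last≢0 : c ℓ ≢ 0
  c-last≢0 c≡0 = <⇒≢ (m<n⇒0<n∸m 2≤q) (trans (sym c≡0) c-last)
  x : Fin q
  x = proj₁ (drop-all-but-last y ys)
  drop≡[x] : drop ℓ p ≡ [ x ]
  drop≡[x] = proj₂ (drop-all-but-last y ys)
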